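{- Let $S=[A_S;P_S;B_S]$ be a recursive system with $A_S\neq\emptyset$, and let $A\supseteq A_S$ be a set of symbols such that $S_A=[A;P_S;B_S]$ is also a recursive system. Let $\gamma:A\to A_S$ be a map with $\gamma(a)=a$ for all $a\in A_S$, and let $\bar\gamma$ be its extension which assigns to every list $\lambda$ and every R-formula $F$ of $S_A$ the list $\bar\gamma(\lambda)$ and the R-formula $\bar\gamma(F)$ of $S$ obtained by simultaneously replacing every symbol $a\in A$ occurring in $\lambda$ resp. $F$ by $\gamma(a)$. If $[F_1;\dots;F_l]$ is an R-derivation in $S_A$, then $[\bar\gamma(F_1);\dots;\bar\gamma(F_l)]$ is an R-derivation in $S$. Moreover, for every R-formula $F$ of $S$ one has $F\in\Pi_R(S_A)$ if and only if $F\in\Pi_R(S)$.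
   Context: A recursive system $S=[A_S;P_S;B_S]$ is given by a finite set $A_S$ of constant/operation symbols, a finite set $P_S$ of predicate symbols, a fixed countably infinite set $X$ of variables and the auxiliary symbols $\sim,(,),\,,\,,\to$ (all these sets pairwise disjoint), together with a finite (possibly empty) list $B_S$ of R-formulas, the basis R-axioms. Lists: every $a\in A_S$ and every $x\in X$ is a list; if $\lambda$ is a list and $f\in A_S$ then $f(\lambda)$ is a list; if $\lambda,\mu$ are lists then their concatenation $\lambda\mu$ is a list. Prime R-formulas: equations $\sim\lambda,\mu$ for lists $\lambda,\mu$, and $p$, $p\,\lambda_1$, $p\,\lambda_1,\lambda_2$, … for $p\in P_S$ and lists $\lambda_i$. R-formulas: every prime R-formula, and $\to F\,G$ whenever $F$ is a prime R-formula and $G$ an R-formula (Polish notation). For an R-formula $F$, a list $\lambda$ and $x\in X$, $F\frac{\lambda}{x}=\mathrm{SbF}(F;\lambda;x)$ is the result of replacing every occurrence of $x$ in $F$ by $\lambda$. R-axioms of equality: $\sim x,x$; $\to\mathrm{SbF}(\sim\lambda,\mu;x;y)\to\ \sim x,y\ \sim\lambda,\mu$ for $x,y\in X$ and lists $\lambda,\mu$; $\to\sim x_1,y_1\dots\to\sim x_n,y_n\to p\,x_1,\dots,x_n\ p\,y_1,\dots,y_n$ for $p\in P_S$, $n\ge1$, $x_i,y_i\in X$. The R-axioms of $S$ are the R-axioms of equality and the members of $B_S$. An R-derivation is a finite list of R-formulas built from the empty list by repeatedly appending (a) an R-axiom, (b) $G$ whenever $F$ and $\to F\,G$ are already steps,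 or (c) $F\frac{\lambda}{x}$ whenever $F$ is already a step, $x\in X$ and $\lambda$ is any list. $\Pi_R(S)$ is the set of R-formulas occurring as steps of R-derivations in $S$. -}

module Defs where

open import Data.Nat using (ℕ; suc; _≟_)
open import Data.List using (List; []; _∷_; _++_; [_]; map; concatMap)
open import Data.List.Membership.Propositional using (_∈_)
open import Data.List.Relation.Unary.All using (All)
open import Data.Vec using (Vec; zip) renaming ([] to []v; _∷_ to _∷v_)
open import Data.Product using (Σ; _×_; _,_)
open import Relation.Nullary using (yes; no)

-- Symbols of a recursive system with constant/operation symbols `Sym`
-- and predicate symbols `Pr`; variables are X = ℕ.
-- ∼ , ( ) , → are the auxiliary symbols.
data Tok (Sym Pr : Set) : Set where
  sym   : Sym → Tok Sym Pr
  var   : ℕ → Tok Sym Pr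
  pred  : Pr → Tok Sym Pr
  tilde : Tok Sym Pr
  lpar  : Tok Sym Pr
  rpar  : Tok Sym Pr
  comma : Tok Sym Pr
  arrow : Tok Sym Pr

Word : Set → Set → Set
Word Sym Pr = List (Tok Sym Pr)

module _ {Sym Pr : Set} where

  data IsList : Word Sym Pr → Set where
    atom : (a : Sym) → IsList [ sym a ]
    vr   : (x : ℕ) → IsList [ var x ]
    app  : (f : Sym) {l : Word Sym Pr} → IsList l →
           IsList (sym f ∷ lpar ∷ l ++ [ rpar ])
    cat  : {l m : Word Sym Pr} → IsList l → IsList m → IsList (l ++ m)

  data IsArgs : Word Sym Pr → Set where
    one  : {l : Word Sym Pr} → IsList l → IsArgs l
    more : {l w : Word Sym Pr} → IsList l → IsArgs w → IsArgs (l ++ comma ∷ w)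

  eqn : Word Sym Pr → Word Sym Pr → Word Sym Pr
  eqn l m = tilde ∷ l ++ comma ∷ m

  -- implication  →F G  (Polish notation)
  imp : Word Sym Pr → Word Sym Pr → Word Sym Pr
  imp F G = arrow ∷ F ++ G

  data IsPrime : Word Sym Pr → Set where
    equation : {l m : Word Sym Pr} → IsList l → IsList m → IsPrime (eqn l m)
    pred0    : (p : Pr) → IsPrime [ pred p ]
    predn    : (p : Pr) {w : Word Sym Pr} → IsArgs w → IsPrime (pred p ∷ w)

  data IsRFormula : Word Sym Pr → Set where
    prime : {F : Word Sym Pr} → IsPrime F → IsRFormula F
    impl  : {F G : Word Sym Pr} → IsPrime F → IsRFormula G → IsRFormula (imp F G)

  SbF : Word Sym Pr → Word Sym Pr → ℕ → Word Sym Pr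
  SbF F l x = concatMap step F
    where
      step : Tok Sym Pr → Word Sym Pr
      step (var y) with y ≟ x
      ... | yes _ = l
      ... | no  _ = [ var y ]
      step t = [ t ]

  varArgs : {n : ℕ} → Vec ℕ (suc n) → Word Sym Pr
  varArgs (x ∷v []v) = [ var x ]
  varArgs (x ∷v (y ∷v ys)) = var x ∷ comma ∷ varArgs (y ∷v ys)

  eqPremises : {n : ℕ} → Vec ℕ n → Vec ℕ n → Word Sym Pr → Word Sym Pr
  eqPremises []v []v G = G
  eqPremises (x ∷v xs) (y ∷v ys) G = imp (eqn [ var x ] [ var y ]) (eqPremises xs ys G)

  data IsEqAxiom : Word Sym Pr → Set where
    refl-ax  : (x : ℕ) → IsEqAxiom (eqn [ var x ] [ var x ])
    subst-ax : (x y : ℕ) {l m : Word Sym Pr} → IsList l → IsList m →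
               IsEqAxiom (imp (SbF (eqn l m) [ var x ] y)
                              (imp (eqn [ var x ] [ var y ]) (eqn l m)))
    pred-ax  : (p : Pr) (n : ℕ) (xs ys : Vec ℕ (suc n)) →
               IsEqAxiom (eqPremises xs ys
                            (imp (pred p ∷ varArgs xs) (pred p ∷ varArgs ys)))

  data IsAxiom (B : List (Word Sym Pr)) : Word Sym Pr → Set where
    equality : {F : Word Sym Pr} → IsEqAxiom F → IsAxiom B F
    basis    : {F : Word Sym Pr} → F ∈ B → IsAxiom B F

  data IsDerivation (B : List (Word Sym Pr)) : List (Word Sym Pr) → Set where
    empty : IsDerivation B []
    axiom : {ds : List (Word Sym Pr)} {F : Word Sym Pr} →
            IsDerivation B ds → IsAxiom B F → IsDerivation B (ds ++ [ F ])
    mp    : {ds : List (Word Sym Pr)} {F G : Word Sym Pr} →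
            IsDerivation B ds → F ∈ ds → imp F G ∈ ds →
            IsDerivation B (ds ++ [ G ])
    subst : {ds : List (Word Sym Pr)} {F l : Word Sym Pr} (x : ℕ) →
            IsDerivation B ds → F ∈ ds → IsList l →
            IsDerivation B (ds ++ [ SbF F l x ])

  ΠR : List (Word Sym Pr) → Word Sym Pr → Set
  ΠR B F = Σ (List (Word Sym Pr)) λ ds → IsDerivation B ds × F ∈ ds

mapTok : {S T Pr : Set} → (S → T) → Tok S Pr → Tok T Pr
mapTok g (sym a) = sym (g a)
mapTok g (var x) = var x
mapTok g (pred p) = pred p
mapTok g tilde = tilde
mapTok g lpar = lpar
mapTok g rpar = rpar
mapTok g comma = comma
mapTok g arrow = arrow

mapWord : {S T Pr : Set} → (S → T) → Word S Pr → Word T Pr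
mapWord g = map (mapTok g)

module Submission where

-- Renaming constant/operation symbols along any map g commutes with SbF and with the
-- shapes ∼λ,μ and →F G, fixes variables, and sends lists to lists; hence it maps equality
-- axioms to equality axioms and R-derivations in one system to R-derivations in another,
-- provided it maps the first basis into the second. With g = γ this transports derivations
-- of S_A to S, because γ ∘ ι = id carries the basis ι(B_S) back onto B_S; with g = ι it
-- embeds derivations of S into S_A.

open import Defs
open import Data.Nat using (ℕ; suc; _≟_)
open import Data.Fin using (Fin)
open import Data.List using (List; map; []; _∷_; _++_; [_])
open import Data.List.Properties using (map-++; map-∘; map-cong; map-id)
open import Data.List.Membership.Propositional using (_∈_)
open import Data.List.Membership.Propositional.Properties using (∈-map⁺)
open import Data.List.Relation.Unary.All using (All)
open import Data.Vec using (Vec) renaming ([] to []v; _∷_ to _∷v_)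
open import Data.Product using (_×_; _,_)
open import Function.Base using (_∘_)
open import Function.Bundles using (_⇔_; mk⇔)
open import Function.Definitions using (Injective)
open import Relation.Binary.PropositionalEquality as ≡
  using (_≡_; refl; trans; cong; cong₂; module ≡-Reasoning)
open import Relation.Nullary using (yes; no)

map-retract : {A B : Set} {f : A → B} {g : B → A} →
              (∀ a → g (f a) ≡ a) → (xs : List A) → map g (map f xs) ≡ xs
map-retract g∘f≗id xs = trans (≡.sym (map-∘ xs)) (trans (map-cong g∘f≗id xs) (map-id xs))

mapTok-retract : {S T Pr : Set} {ι : S → T} {γ : T → S} →
                 (∀ a → γ (ι a) ≡ a) → (t : Tok S Pr) → mapTok γ (mapTok ι t) ≡ t
mapTok-retract γ∘ι≗id (sym a) = cong sym (γ∘ι≗id a)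
mapTok-retract γ∘ι≗id (var x) = refl
mapTok-retract γ∘ι≗id (pred p) = refl
mapTok-retract γ∘ι≗id tilde = refl
mapTok-retract γ∘ι≗id lpar = refl
mapTok-retract γ∘ι≗id rpar = refl
mapTok-retract γ∘ι≗id comma = refl
mapTok-retract γ∘ι≗id arrow = refl

mapWord-retract : {S T Pr : Set} {ι : S → T} {γ : T → S} →
                  (∀ a → γ (ι a) ≡ a) → (F : Word S Pr) → mapWord γ (mapWord ι F) ≡ F
mapWord-retract γ∘ι≗id = map-retract (mapTok-retract γ∘ι≗id)

module _ {S T Pr : Set} (g : S → T) where

  private
    ĝ : Word S Pr → Word T Pr
    ĝ = mapWord g

  mapWord-imp : ∀ F G → ĝ (imp F G) ≡ imp (ĝ F) (ĝ G)
  mapWord-imp F G = cong (arrow ∷_) (map-++ (mapTok g) F G)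

  mapWord-eqn : ∀ l m → ĝ (eqn l m) ≡ eqn (ĝ l) (ĝ m)
  mapWord-eqn l m = cong (tilde ∷_) (map-++ (mapTok g) l (comma ∷ m))

  mapWord-SbF : ∀ F l x → ĝ (SbF F l x) ≡ SbF (ĝ F) (ĝ l) x
  mapWord-SbF [] l x = refl
  mapWord-SbF (var y ∷ F) l x with y ≟ x
  ... | yes _ = trans (map-++ (mapTok g) l _) (cong (ĝ l ++_) (mapWord-SbF F l x))
  ... | no  _ = cong (var y ∷_) (mapWord-SbF F l x)
  mapWord-SbF (sym a ∷ F) l x = cong (sym (g a) ∷_) (mapWord-SbF F l x)
  mapWord-SbF (pred p ∷ F) l x = cong (pred p ∷_) (mapWord-SbF F l x)
  mapWord-SbF (tilde ∷ F) l x = cong (tilde ∷_) (mapWord-SbF F l x)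
  mapWord-SbF (lpar ∷ F) l x = cong (lpar ∷_) (mapWord-SbF F l x)
  mapWord-SbF (rpar ∷ F) l x = cong (rpar ∷_) (mapWord-SbF F l x)
  mapWord-SbF (comma ∷ F) l x = cong (comma ∷_) (mapWord-SbF F l x)
  mapWord-SbF (arrow ∷ F) l x = cong (arrow ∷_) (mapWord-SbF F l x)

  mapWord-varArgs : ∀ {n} (xs : Vec ℕ (suc n)) → ĝ (varArgs xs) ≡ varArgs xs
  mapWord-varArgs (x ∷v []v) = refl
  mapWord-varArgs (x ∷v (y ∷v ys)) = cong (λ w → var x ∷ comma ∷ w) (mapWord-varArgs (y ∷v ys))

  mapWord-eqPremises : ∀ {n} (xs ys : Vec ℕ n) G →
                       ĝ (eqPremises xs ys G) ≡ eqPremises xs ys (ĝ G)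
  mapWord-eqPremises []v []v G = refl
  mapWord-eqPremises (x ∷v xs) (y ∷v ys) G =
    cong (λ w → arrow ∷ tilde ∷ var x ∷ comma ∷ var y ∷ w) (mapWord-eqPremises xs ys G)

  IsList-mapWord : ∀ {l} → IsList l → IsList (ĝ l)
  IsList-mapWord (atom a) = atom (g a)
  IsList-mapWord (vr x) = vr x
  IsList-mapWord (app f {l} p) =
    ≡.subst (λ w → IsList (sym (g f) ∷ lpar ∷ w)) (≡.sym (map-++ (mapTok g) l [ rpar ]))
          (app (g f) (IsList-mapWord p))
  IsList-mapWord (cat {l} {m} p q) =
    ≡.subst IsList (≡.sym (map-++ (mapTok g) l m)) (cat (IsList-mapWord p) (IsList-mapWord q))

  IsEqAxiom-mapWord : ∀ {F} → IsEqAxiom F → IsEqAxiom (ĝ F)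
  IsEqAxiom-mapWord (refl-ax x) = refl-ax x
  IsEqAxiom-mapWord (subst-ax x y {l} {m} p q) =
    ≡.subst IsEqAxiom (≡.sym commute) (subst-ax x y (IsList-mapWord p) (IsList-mapWord q))
    where
    open ≡-Reasoning
    x≈y : {A : Set} → Word A Pr
    x≈y = eqn [ var x ] [ var y ]
    commute : ĝ (imp (SbF (eqn l m) [ var x ] y) (imp x≈y (eqn l m)))
            ≡ imp (SbF (eqn (ĝ l) (ĝ m)) [ var x ] y) (imp x≈y (eqn (ĝ l) (ĝ m)))
    commute = begin
      ĝ (imp (SbF (eqn l m) [ var x ] y) (imp x≈y (eqn l m)))
        ≡⟨ mapWord-imp (SbF (eqn l m) [ var x ] y) (imp x≈y (eqn l m)) ⟩
      imp (ĝ (SbF (eqn l m) [ var x ] y)) (ĝ (imp x≈y (eqn l m)))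
        ≡⟨ cong₂ imp (mapWord-SbF (eqn l m) [ var x ] y) (mapWord-imp x≈y (eqn l m)) ⟩
      imp (SbF (ĝ (eqn l m)) [ var x ] y) (imp x≈y (ĝ (eqn l m)))
        ≡⟨ cong (λ e → imp (SbF e [ var x ] y) (imp x≈y e)) (mapWord-eqn l m) ⟩
      imp (SbF (eqn (ĝ l) (ĝ m)) [ var x ] y) (imp x≈y (eqn (ĝ l) (ĝ m))) ∎
  IsEqAxiom-mapWord (pred-ax p n xs ys) = ≡.subst IsEqAxiom (≡.sym commute) (pred-ax p n xs ys)
    where
    open ≡-Reasoning
    commute : ĝ (eqPremises xs ys (imp (pred p ∷ varArgs xs) (pred p ∷ varArgs ys)))
            ≡ eqPremises xs ys (imp (pred p ∷ varArgs xs) (pred p ∷ varArgs ys))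
    commute = begin
      ĝ (eqPremises xs ys (imp (pred p ∷ varArgs xs) (pred p ∷ varArgs ys)))
        ≡⟨ mapWord-eqPremises xs ys (imp (pred p ∷ varArgs xs) (pred p ∷ varArgs ys)) ⟩
      eqPremises xs ys (ĝ (imp (pred p ∷ varArgs xs) (pred p ∷ varArgs ys)))
        ≡⟨ cong (eqPremises xs ys) (mapWord-imp (pred p ∷ varArgs xs) (pred p ∷ varArgs ys)) ⟩
      eqPremises xs ys (imp (pred p ∷ ĝ (varArgs xs)) (pred p ∷ ĝ (varArgs ys)))
        ≡⟨ cong (eqPremises xs ys) (cong₂ imp (cong (pred p ∷_) (mapWord-varArgs xs))
                                              (cong (pred p ∷_) (mapWord-varArgs ys))) ⟩
      eqPremises xs ys (imp (pred p ∷ varArgs xs) (pred p ∷ varArgs ys)) ∎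

  module _ {B : List (Word S Pr)} {B′ : List (Word T Pr)}
           (basis-mapWord : ∀ {F} → F ∈ B → ĝ F ∈ B′) where

    IsAxiom-mapWord : ∀ {F} → IsAxiom B F → IsAxiom B′ (ĝ F)
    IsAxiom-mapWord (equality e) = equality (IsEqAxiom-mapWord e)
    IsAxiom-mapWord (basis F∈B) = basis (basis-mapWord F∈B)

    IsDerivation-mapWord : ∀ {ds} → IsDerivation B ds → IsDerivation B′ (map ĝ ds)
    IsDerivation-mapWord empty = empty
    IsDerivation-mapWord (axiom {ds} {F} d a) =
      ≡.subst (IsDerivation B′) (≡.sym (map-++ ĝ ds [ F ]))
            (axiom (IsDerivation-mapWord d) (IsAxiom-mapWord a))
    IsDerivation-mapWord (mp {ds} {F} {G} d F∈ds F⇒G∈ds) =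
      ≡.subst (IsDerivation B′) (≡.sym (map-++ ĝ ds [ G ]))
            (mp (IsDerivation-mapWord d) (∈-map⁺ ĝ F∈ds)
                (≡.subst (_∈ map ĝ ds) (mapWord-imp F G) (∈-map⁺ ĝ F⇒G∈ds)))
    IsDerivation-mapWord (subst {ds} {F} {l} x d F∈ds p) =
      ≡.subst (IsDerivation B′)
            (≡.sym (trans (map-++ ĝ ds _) (cong (λ w → map ĝ ds ++ [ w ]) (mapWord-SbF F l x))))
            (IsDerivation.subst x (IsDerivation-mapWord d) (∈-map⁺ ĝ F∈ds) (IsList-mapWord p))

    ΠR-mapWord : ∀ {F} → ΠR B F → ΠR B′ (ĝ F)
    ΠR-mapWord (ds , d , F∈ds) = map ĝ ds , IsDerivation-mapWord d , ∈-map⁺ ĝ F∈ds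

mainTheorem1 : (m n k : ℕ) (ι : Fin (suc m) → Fin n) → Injective _≡_ _≡_ ι →
    (B : List (Word (Fin (suc m)) (Fin k))) → All IsRFormula B →
    (γ : Fin n → Fin (suc m)) → (∀ a → γ (ι a) ≡ a) →
    ((ds : List (Word (Fin n) (Fin k))) →
    IsDerivation (map (mapWord ι) B) ds →
    IsDerivation B (map (mapWord γ) ds))
    × ((F : Word (Fin (suc m)) (Fin k)) → IsRFormula F →
    (ΠR (map (mapWord ι) B) (mapWord ι F) ⇔ ΠR B F))
mainTheorem1 m n k ι _ B _ γ γ∘ι≗id =
  (λ _ → IsDerivation-mapWord γ γ-basis) ,
  λ F _ → mk⇔ (≡.subst (ΠR B) (mapWord-retract γ∘ι≗id F) ∘ ΠR-mapWord γ γ-basis)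
              (ΠR-mapWord ι (∈-map⁺ (mapWord ι)))
  where
  γ-basis : ∀ {F} → F ∈ map (mapWord ι) B → mapWord γ F ∈ B
  γ-basis F∈ιB = ≡.subst (_ ∈_) (map-retract (mapWord-retract γ∘ι≗id) B) (∈-map⁺ (mapWord γ) F∈ιB)
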